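{- For every integer $q\ge 2$, the graph $KM_q$ is $2K_2$-free, has chromatic number $2q$, and admits a frozen $(2q+1)$-colouring.
   Context: For $q\ge 2$, $\overline{ME_q}$ is the graph with the $4q+2$ vertices $u_0,u_1,\dots,u_{q+1}$ and $v_{i1},v_{i2},v_{i3}$ ($i=1,\dots,q$), whose edges are: the edges of the Hamiltonian cycle $u_0,u_1,\dots,u_{q+1},v_{11},v_{12},v_{13},v_{21},v_{22},v_{23},\dots,v_{q1},v_{q2},v_{q3},u_0$; the edges $u_iv_{i2}$ for $i=1,\dots,q$; and the edges $v_{i1}v_{i3}$ for $i=1,\dots,q$. $\overline{KM_q}$ is obtained from $\overline{ME_q}$ by deleting the edges $u_1u_2,\dots,u_{q-1}u_q$, and $KM_q$ is the complement of $\overline{KM_q}$. A $k$-colouring is a partition of the vertex set into at most $k$ (ordered, possibly empty) independent sets (colour classes); it is frozen if every vertex $v$ has a neighbour in each of the $k$ colour classes other than its own. $2K_2$ is the disjoint union of two edges; a graph is $2K_2$-free if it has no induced $2K_2$. -}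

module Defs where

open import Data.Nat using (ℕ; zero; suc; _+_; _*_; _<_)
open import Data.Fin using (Fin; toℕ)
open import Data.Product using (Σ; ∃; _×_; _,_)
open import Data.Sum using (_⊎_)
open import Relation.Nullary using (¬_)
open import Relation.Binary.PropositionalEquality using (_≡_; _≢_)

record Graph : Set₁ where
  field
    Vertex : Set
    Adj    : Vertex → Vertex → Set

open Graph public

complement : Graph → Graph
complement G = record
  { Vertex = Vertex G
  ; Adj    = λ x y → x ≢ y × ¬ Adj G x y }

-- G contains no induced 2K₂: there are no vertices a,b,c,d with
-- ab and cd edges and none of ac, ad, bc, bd an edge.
-- (Distinctness of a,b,c,d follows for loopless graphs, since ab and
-- cd are edges while the cross pairs are not.)
2K₂-free : Graph → Set
2K₂-free G = ∀ a b c d → Adj G a b → Adj G c d →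
  ¬ (¬ Adj G a c × ¬ Adj G a d × ¬ Adj G b c × ¬ Adj G b d)

IsColouring : (G : Graph) (k : ℕ) → (Vertex G → Fin k) → Set
IsColouring G k c = ∀ x y → Adj G x y → c x ≢ c y

Colourable : Graph → ℕ → Set
Colourable G k = Σ (Vertex G → Fin k) (IsColouring G k)

ChromaticNumber : Graph → ℕ → Set
ChromaticNumber G m = Colourable G m × (∀ k → k < m → ¬ Colourable G k)

IsFrozen : (G : Graph) (k : ℕ) → (Vertex G → Fin k) → Set
IsFrozen G k c = ∀ v (a : Fin k) → a ≢ c v → ∃ λ w → Adj G v w × c w ≡ a

HasFrozenColouring : Graph → ℕ → Set
HasFrozenColouring G k =
  Σ (Vertex G → Fin k) λ c → IsColouring G k c × IsFrozen G k c

-- The graphs  \overline{KM_q}  and  KM_q.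
-- Vertices: u i  (i = 0,…,q+1)  and  v i j  with i : Fin q standing for
-- the paper's index i+1 ∈ {1,…,q}, and j : Fin 3 standing for j+1.

data KMVertex (q : ℕ) : Set where
  u : Fin (q + 2) → KMVertex q
  v : Fin q → Fin 3 → KMVertex q

-- Edges of \overline{KM_q} (each listed in one orientation).  Numeric
-- indices below are the paper's: v i j here is v_{(i+1)(j+1)} there.
data KMbarEdge (q : ℕ) : KMVertex q → KMVertex q → Set where
  -- Hamiltonian cycle, path part on the u's: only u₀u₁ and u_q u_{q+1}
  -- survive (u₁u₂,…,u_{q-1}u_q are deleted)
  e-u0u1   : ∀ a b → toℕ a ≡ 0 → toℕ b ≡ 1 → KMbarEdge q (u a) (u b)
  e-uquq1  : ∀ a b → toℕ a ≡ q → toℕ b ≡ suc q → KMbarEdge q (u a) (u b)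
  e-uq1v11 : ∀ a i j → toℕ a ≡ suc q → toℕ i ≡ 0 → toℕ j ≡ 0 →
             KMbarEdge q (u a) (v i j)
  e-v12    : ∀ i j k → toℕ j ≡ 0 → toℕ k ≡ 1 → KMbarEdge q (v i j) (v i k)
  e-v23    : ∀ i j k → toℕ j ≡ 1 → toℕ k ≡ 2 → KMbarEdge q (v i j) (v i k)
  e-v3v1   : ∀ i i' j k → suc (toℕ i) ≡ toℕ i' → toℕ j ≡ 2 → toℕ k ≡ 0 →
             KMbarEdge q (v i j) (v i' k)
  e-vq3u0  : ∀ i j a → suc (toℕ i) ≡ q → toℕ j ≡ 2 → toℕ a ≡ 0 →
             KMbarEdge q (v i j) (u a)
  e-uivi2  : ∀ a i j → toℕ a ≡ suc (toℕ i) → toℕ j ≡ 1 →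
             KMbarEdge q (u a) (v i j)
  e-v13    : ∀ i j k → toℕ j ≡ 0 → toℕ k ≡ 2 → KMbarEdge q (v i j) (v i k)

KMbar : ℕ → Graph
KMbar q = record
  { Vertex = KMVertex q
  ; Adj    = λ x y → KMbarEdge q x y ⊎ KMbarEdge q y x }

KM : ℕ → Graph
KM q = complement (KMbar q)

-- A 2K₂ of KM_q is an induced 4-cycle of its complement \overline{KM_q}.  There every
-- v_{ij} lies on the triangle v_{i1}v_{i2}v_{i3} and has exactly one neighbour outside it,
-- the outside neighbours of one triangle are pairwise non-adjacent, and the edges among the
-- u_n form a matching; hence no induced 4-cycle meets a triangle, and none lies among the u_n.
-- Colour classes of KM_q are cliques of \overline{KM_q}: the q triangles, {u₀,u₁},
-- {u_q,u_{q+1}} and the singletons u₂,…,u_{q-1} give 2q colours, and 2q are needed since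
-- u₁,…,u_q,v_{11},…,v_{q1} are pairwise non-adjacent in \overline{KM_q}.  Finally the 2q+1
-- edges leaving the triangles form a perfect matching of \overline{KM_q}, and none of them lies
-- on a triangle, so no vertex is adjacent to both ends of another matching edge: the matching
-- is a frozen (2q+1)-colouring of KM_q.
module Submission where

open import Defs
open import Data.Nat
  using (ℕ; zero; suc; pred; _+_; _*_; _<_; _≤_; z≤n; s≤s; s≤s⁻¹; s<s⁻¹; _≟_)
open import Data.Nat.Properties
  using ( ≤-refl; ≤-trans; <-≤-trans; ≤-<-trans; <⇒≤; <⇒≱; n≮n; n≤1+n; m≤m+n
        ; m<1+n⇒m≤n; ≤∧≢⇒<; pred-mono-≤; +-monoʳ-<; +-cancelˡ-≡; +-cancelˡ-<; +-comm
        ; +-identityʳ; suc-injective; m≢1+m+n; <-irrelevant; <-cmp; m≤n⇒∃[o]m+o≡n )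
open import Data.Fin using (Fin; zero; suc; toℕ; fromℕ<)
open import Data.Fin.Properties
  using (toℕ-injective; toℕ<n; toℕ-fromℕ<; fromℕ<-injective; pigeonhole; *↔×)
  renaming (<⇒≢ to <⇒≢ᶠ)
open import Data.Product using (∃; _×_; _,_; proj₁; proj₂)
open import Data.Sum using (_⊎_; inj₁; inj₂; [_,_]′)
import Data.Sum as Sum
open import Data.Empty using (⊥; ⊥-elim)
open import Function using (_∘_)
open import Function.Bundles using (Inverse; Injection)
open import Function.Properties.Inverse using (↔⇒↣)
open import Relation.Nullary using (¬_; yes; no)
open import Relation.Binary.Definitions using (Symmetric; tri<; tri≈; tri>)
open import Relation.Binary.PropositionalEquality
  using (_≡_; _≢_; refl; sym; trans; cong; subst)

InducedC₄-free : Graph → Set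
InducedC₄-free G = ∀ a b c d → Adj G a c → Adj G c b → Adj G b d → Adj G d a →
  Adj (complement G) a b → Adj (complement G) c d → ⊥

complement-symmetric : (G : Graph) → Symmetric (Adj G) → Symmetric (Adj (complement G))
complement-symmetric G sym-G (x≢y , ¬xy) = (x≢y ∘ sym) , (¬xy ∘ sym-G)

C₄-free⇒complement-2K₂-free :
  (G : Graph) → Symmetric (Adj G) → InducedC₄-free G → 2K₂-free (complement G)
C₄-free⇒complement-2K₂-free G sym-G free a b c d ab cd (¬ac , ¬ad , ¬bc , ¬bd) =
  ¬ac ((λ { refl → ¬ad cd }) , λ ac →
  ¬ad ((λ { refl → ¬ac (co-sym cd) }) , λ ad →
  ¬bc ((λ { refl → ¬bd cd }) , λ bc →
  ¬bd ((λ { refl → ¬bc (co-sym cd) }) , λ bd →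
  free a b c d ac (sym-G bc) bd (sym-G ad) ab cd))))
  where co-sym = complement-symmetric G sym-G

record InducedEmbedding (G H : Graph) : Set where
  field
    embed     : Vertex G → Vertex H
    injective : ∀ {x y} → embed x ≡ embed y → x ≡ y
    preserves : ∀ {x y} → Adj G x y → Adj H (embed x) (embed y)
    reflects  : ∀ {x y} → Adj H (embed x) (embed y) → Adj G x y

  complement-preserves :
    ∀ {x y} → Adj (complement G) x y → Adj (complement H) (embed x) (embed y)
  complement-preserves (x≢y , ¬xy) = (x≢y ∘ injective) , (¬xy ∘ reflects)

  equal-or-adjacent :
    ∀ {x y} → embed x ≡ embed y ⊎ Adj H (embed x) (embed y) → x ≡ y ⊎ Adj G x y
  equal-or-adjacent = Sum.map injective reflects

C₄-free-embedding :
  {G H : Graph} → InducedEmbedding G H → InducedC₄-free H → InducedC₄-free G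
C₄-free-embedding emb free a b c d ac cb bd da ab cd =
  free (embed a) (embed b) (embed c) (embed d)
       (preserves ac) (preserves cb) (preserves bd) (preserves da)
       (complement-preserves ab) (complement-preserves cd)
  where open InducedEmbedding emb

clique⇒¬colourable : (G : Graph) {m k : ℕ} (f : Fin m → Vertex G) →
  (∀ {s t} → s ≢ t → Adj G (f s) (f t)) → k < m → ¬ Colourable G k
clique⇒¬colourable G f clique k<m (c , proper) with pigeonhole k<m (c ∘ f)
... | s , t , s<t , cs≡ct = proper (f s) (f t) (clique (<⇒≢ᶠ s<t)) cs≡ct

module ComplementColouring
  (H : Graph) {k : ℕ} (c : Vertex H → ℕ) (c<k : ∀ x → c x < k) where

  colouring : Vertex H → Fin k
  colouring x = fromℕ< (c<k x)

  colouring-toℕ : ∀ {x a} → c x ≡ toℕ a → colouring x ≡ a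
  colouring-toℕ {x} eq = toℕ-injective (trans (toℕ-fromℕ< (c<k x)) eq)

  clique-classes⇒colouring :
    (∀ x y → c x ≡ c y → x ≡ y ⊎ Adj H x y) → IsColouring (complement H) k colouring
  clique-classes⇒colouring cliques x y (x≢y , ¬xy) same =
    [ x≢y , ¬xy ]′ (cliques x y (fromℕ<-injective _ _ (c<k x) (c<k y) same))

  non-neighbours⇒frozen :
    (∀ x n → n < k → n ≢ c x → ∃ λ w → c w ≡ n × ¬ Adj H x w) →
    IsFrozen (complement H) k colouring
  non-neighbours⇒frozen non-neighbour x a a≢cx
    with non-neighbour x (toℕ a) (toℕ<n a) (a≢cx ∘ sym ∘ colouring-toℕ ∘ sym)
  ... | w , cw≡a , ¬xw =
    w , ((λ { refl → a≢cx (sym (colouring-toℕ cw≡a)) }) , ¬xw) , colouring-toℕ cw≡a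

-- Vertices coded with ℕ indices, so that edges can be matched on: U n is u_n and V i j is
-- v i j of KMVertex (the paper's v_{(i+1)(j+1)}); j₁, j₂, j₃ are the paper's second indices.
data Code : Set where
  U : ℕ → Code
  V : ℕ → Fin 3 → Code

pattern j₁ = zero
pattern j₂ = suc zero
pattern j₃ = suc (suc zero)

U-injective : ∀ {m n} → U m ≡ U n → m ≡ n
U-injective refl = refl

V-injective : ∀ {i i′ j j′} → V i j ≡ V i′ j′ → i ≡ i′ × j ≡ j′
V-injective refl = refl , refl

module Structure (r : ℕ) where

  q : ℕ
  q = 2 + r

  -- Codes that encode no vertex of KMbar q only span isolated triangles and vertices.
  data Edge : Code → Code → Set where
    u0u1   : Edge (U 0) (U 1)
    uquq1  : Edge (U q) (U (suc q))
    uq1v11 : Edge (U (suc q)) (V 0 j₁)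
    v12    : ∀ i → Edge (V i j₁) (V i j₂)
    v23    : ∀ i → Edge (V i j₂) (V i j₃)
    v13    : ∀ i → Edge (V i j₁) (V i j₃)
    v3v1   : ∀ i → suc i < q → Edge (V i j₃) (V (suc i) j₁)
    vq3u0  : Edge (V (suc r) j₃) (U 0)
    uivi2  : ∀ i → i < q → Edge (U (suc i)) (V i j₂)

  _∼_ : Code → Code → Set
  X ∼ Y = Edge X Y ⊎ Edge Y X

  codeGraph : Graph
  codeGraph = record { Vertex = Code ; Adj = _∼_ }

  _≁_ : Code → Code → Set
  X ≁ Y = Adj (complement codeGraph) X Y

  ∼-sym : Symmetric _∼_
  ∼-sym = Sum.swap

  ≁-sym : Symmetric _≁_
  ≁-sym = complement-symmetric codeGraph ∼-sym

  block-clique : ∀ i j k → V i j ≡ V i k ⊎ V i j ∼ V i k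
  block-clique i j₁ j₁ = inj₁ refl
  block-clique i j₁ j₂ = inj₂ (inj₁ (v12 i))
  block-clique i j₁ j₃ = inj₂ (inj₁ (v13 i))
  block-clique i j₂ j₁ = inj₂ (inj₂ (v12 i))
  block-clique i j₂ j₂ = inj₁ refl
  block-clique i j₂ j₃ = inj₂ (inj₁ (v23 i))
  block-clique i j₃ j₁ = inj₂ (inj₂ (v13 i))
  block-clique i j₃ j₂ = inj₂ (inj₂ (v23 i))
  block-clique i j₃ j₃ = inj₁ refl

  block-mates-adjacent : ∀ {i} j k → ¬ V i j ≁ V i k
  block-mates-adjacent j k (≢ , ≁) = [ ≢ , ≁ ]′ (block-clique _ j k)

  U-matching : ∀ {n m m′} → U n ∼ U m → U n ∼ U m′ → U m ≡ U m′
  U-matching (inj₁ u0u1)  (inj₁ u0u1)  = refl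
  U-matching (inj₁ uquq1) (inj₁ uquq1) = refl
  U-matching (inj₂ u0u1)  (inj₂ u0u1)  = refl
  U-matching (inj₂ uquq1) (inj₂ uquq1) = refl

  data ExternalEdge : Code → Code → Set where
    ext-v11 : ExternalEdge (V 0 j₁) (U (suc q))
    ext-vi1 : ∀ i → suc i < q → ExternalEdge (V (suc i) j₁) (V i j₃)
    ext-vi2 : ∀ i → i < q → ExternalEdge (V i j₂) (U (suc i))
    ext-vi3 : ∀ i → suc i < q → ExternalEdge (V i j₃) (V (suc i) j₁)
    ext-vq3 : ExternalEdge (V (suc r) j₃) (U 0)

  external-adjacent : ∀ {X Y} → ExternalEdge X Y → X ∼ Y
  external-adjacent ext-v11       = inj₂ uq1v11
  external-adjacent (ext-vi1 i p) = inj₂ (v3v1 i p)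
  external-adjacent (ext-vi2 i p) = inj₂ (uivi2 i p)
  external-adjacent (ext-vi3 i p) = inj₁ (v3v1 i p)
  external-adjacent ext-vq3       = inj₁ vq3u0

  block-or-external : ∀ {i j Y} → V i j ∼ Y → (∃ λ k → Y ≡ V i k) ⊎ ExternalEdge (V i j) Y
  block-or-external (inj₁ (v12 i))     = inj₁ (j₂ , refl)
  block-or-external (inj₁ (v23 i))     = inj₁ (j₃ , refl)
  block-or-external (inj₁ (v13 i))     = inj₁ (j₃ , refl)
  block-or-external (inj₁ (v3v1 i p))  = inj₂ (ext-vi3 i p)
  block-or-external (inj₁ vq3u0)       = inj₂ ext-vq3
  block-or-external (inj₂ uq1v11)      = inj₂ ext-v11
  block-or-external (inj₂ (v12 i))     = inj₁ (j₁ , refl)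
  block-or-external (inj₂ (v23 i))     = inj₁ (j₂ , refl)
  block-or-external (inj₂ (v13 i))     = inj₁ (j₁ , refl)
  block-or-external (inj₂ (v3v1 i p))  = inj₂ (ext-vi1 i p)
  block-or-external (inj₂ (uivi2 i p)) = inj₂ (ext-vi2 i p)

  external-unique : ∀ {X Y Z} → ExternalEdge X Y → ExternalEdge X Z → Y ≡ Z
  external-unique ext-v11       ext-v11       = refl
  external-unique (ext-vi1 _ _) (ext-vi1 _ _) = refl
  external-unique (ext-vi2 _ _) (ext-vi2 _ _) = refl
  external-unique (ext-vi3 _ _) (ext-vi3 _ _) = refl
  external-unique (ext-vi3 _ p) ext-vq3       = ⊥-elim (n≮n _ p)
  external-unique ext-vq3       (ext-vi3 _ p) = ⊥-elim (n≮n _ p)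
  external-unique ext-vq3       ext-vq3       = refl

  external-injective : ∀ {X X′ Y} → ExternalEdge X Y → ExternalEdge X′ Y → X ≡ X′
  external-injective ext-v11       ext-v11       = refl
  external-injective ext-v11       (ext-vi2 _ p) = ⊥-elim (n≮n _ p)
  external-injective (ext-vi1 _ _) (ext-vi1 _ _) = refl
  external-injective (ext-vi2 _ p) ext-v11       = ⊥-elim (n≮n _ p)
  external-injective (ext-vi2 _ _) (ext-vi2 _ _) = refl
  external-injective (ext-vi3 _ _) (ext-vi3 _ _) = refl
  external-injective ext-vq3       ext-vq3       = refl

  external-leaves-block : ∀ {i j k} → ¬ ExternalEdge (V i j) (V i k)
  external-leaves-block ()

  external-ends-no-edge :
    ∀ {i j k Y Z} → ExternalEdge (V i j) Y → ExternalEdge (V i k) Z → ¬ Edge Y Z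
  external-ends-no-edge ext-vq3       () u0u1
  external-ends-no-edge (ext-vi2 _ _) () uquq1
  external-ends-no-edge ext-v11       () uq1v11
  external-ends-no-edge (ext-vi3 _ _) () (v12 _)
  external-ends-no-edge (ext-vi3 _ _) () (v13 _)
  external-ends-no-edge (ext-vi1 _ _) () (v3v1 _ _)
  external-ends-no-edge (ext-vi1 _ _) () vq3u0
  external-ends-no-edge _             () (uivi2 _ _)

  external-ends-nonadjacent :
    ∀ {i j k Y Z} → ExternalEdge (V i j) Y → ExternalEdge (V i k) Z → ¬ Y ∼ Z
  external-ends-nonadjacent eY eZ = [ external-ends-no-edge eY eZ , external-ends-no-edge eZ eY ]′

  square-through-mate-has-chord :
    ∀ {i j k b d} → V i k ∼ b → b ∼ d → ExternalEdge (V i j) d → ¬ V i j ≁ b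
  square-through-mate-has-chord kb bd ext-d ab with block-or-external kb
  ... | inj₁ (m , refl) = block-mates-adjacent _ m ab
  ... | inj₂ ext-b      = external-ends-nonadjacent ext-b ext-d bd

  block-vertex-not-on-C₄ :
    ∀ {i j b c d} → V i j ∼ c → c ∼ b → b ∼ d → d ∼ V i j → V i j ≁ b → c ≁ d → ⊥
  block-vertex-not-on-C₄ ac cb bd da ab cd
    with block-or-external ac | block-or-external (∼-sym da)
  ... | inj₁ (k , refl) | inj₁ (k′ , refl) = block-mates-adjacent k k′ cd
  ... | inj₁ (k , refl) | inj₂ ext-d       = square-through-mate-has-chord cb bd ext-d ab
  ... | inj₂ ext-c      | inj₁ (k , refl)  =
    square-through-mate-has-chord (∼-sym bd) (∼-sym cb) ext-c ab
  ... | inj₂ ext-c      | inj₂ ext-d       = proj₁ cd (external-unique ext-c ext-d)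

  codeGraph-C₄-free : InducedC₄-free codeGraph
  codeGraph-C₄-free (V _ _) b c d ac cb bd da ab cd =
    block-vertex-not-on-C₄ ac cb bd da ab cd
  codeGraph-C₄-free (U _) b (V _ _) d ac cb bd da ab cd =
    block-vertex-not-on-C₄ cb bd da ac cd (≁-sym ab)
  codeGraph-C₄-free (U _) (V _ _) (U _) d ac cb bd da ab cd =
    block-vertex-not-on-C₄ bd da ac cb (≁-sym ab) (≁-sym cd)
  codeGraph-C₄-free (U _) (U _) (U _) (V _ _) ac cb bd da ab cd =
    block-vertex-not-on-C₄ da ac cb bd (≁-sym cd) ab
  codeGraph-C₄-free (U _) (U _) (U _) (U _) ac cb bd da ab cd =
    proj₁ cd (U-matching ac (∼-sym da))

  code : KMVertex q → Code
  code (u a)   = U (toℕ a)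
  code (v i j) = V (toℕ i) j

  code-injective : ∀ {x y} → code x ≡ code y → x ≡ y
  code-injective {u a}   {u b}     eq = cong u (toℕ-injective (U-injective eq))
  code-injective {v i j} {v i′ j′} eq with V-injective eq
  ... | i≡i′ , refl = cong (λ i → v i j) (toℕ-injective i≡i′)

  code-preserves-edges : ∀ {x y} → KMbarEdge q x y → Edge (code x) (code y)
  code-preserves-edges (e-u0u1 a b a≡0 b≡1) rewrite a≡0 | b≡1 = u0u1
  code-preserves-edges (e-uquq1 a b a≡q b≡q+1) rewrite a≡q | b≡q+1 = uquq1
  code-preserves-edges (e-uq1v11 a i j a≡q+1 i≡0 j≡0)
    rewrite a≡q+1 | i≡0 | toℕ-injective {j = j₁} j≡0 = uq1v11
  code-preserves-edges (e-v12 i j k j≡0 k≡1)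
    rewrite toℕ-injective {j = j₁} j≡0 | toℕ-injective {j = j₂} k≡1 = v12 (toℕ i)
  code-preserves-edges (e-v23 i j k j≡1 k≡2)
    rewrite toℕ-injective {j = j₂} j≡1 | toℕ-injective {j = j₃} k≡2 = v23 (toℕ i)
  code-preserves-edges (e-v13 i j k j≡0 k≡2)
    rewrite toℕ-injective {j = j₁} j≡0 | toℕ-injective {j = j₃} k≡2 = v13 (toℕ i)
  code-preserves-edges (e-v3v1 i i′ j k i+1≡i′ j≡2 k≡0)
    rewrite sym i+1≡i′ | toℕ-injective {j = j₃} j≡2 | toℕ-injective {j = j₁} k≡0 =
    v3v1 (toℕ i) (subst (_< q) (sym i+1≡i′) (toℕ<n i′))
  code-preserves-edges (e-vq3u0 i j a i+1≡q j≡2 a≡0)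
    rewrite suc-injective i+1≡q | toℕ-injective {j = j₃} j≡2 | a≡0 = vq3u0
  code-preserves-edges (e-uivi2 a i j a≡i+1 j≡1)
    rewrite a≡i+1 | toℕ-injective {j = j₂} j≡1 = uivi2 (toℕ i) (toℕ<n i)

  -- code x ≡ X with the ℕ indices kept as equations, so that matching on an Edge between
  -- codes does not get stuck on toℕ.
  data Encodes : KMVertex q → Code → Set where
    u≈ : ∀ {a n} → toℕ a ≡ n → Encodes (u a) (U n)
    v≈ : ∀ {i j m} → toℕ i ≡ m → Encodes (v i j) (V m j)

  encodes : ∀ x → Encodes x (code x)
  encodes (u a)   = u≈ refl
  encodes (v i j) = v≈ refl

  edge-decodes : ∀ {X Y x y} → Edge X Y → Encodes x X → Encodes y Y → KMbarEdge q x y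
  edge-decodes u0u1   (u≈ a≡0)   (u≈ b≡1)   = e-u0u1 _ _ a≡0 b≡1
  edge-decodes uquq1  (u≈ a≡q)   (u≈ b≡q+1) = e-uquq1 _ _ a≡q b≡q+1
  edge-decodes uq1v11 (u≈ a≡q+1) (v≈ i≡0)   = e-uq1v11 _ _ _ a≡q+1 i≡0 refl
  edge-decodes (v12 _) (v≈ i≡m) (v≈ i′≡m)
    rewrite toℕ-injective (trans i≡m (sym i′≡m)) = e-v12 _ _ _ refl refl
  edge-decodes (v23 _) (v≈ i≡m) (v≈ i′≡m)
    rewrite toℕ-injective (trans i≡m (sym i′≡m)) = e-v23 _ _ _ refl refl
  edge-decodes (v13 _) (v≈ i≡m) (v≈ i′≡m)
    rewrite toℕ-injective (trans i≡m (sym i′≡m)) = e-v13 _ _ _ refl refl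
  edge-decodes (v3v1 _ _) (v≈ i≡m) (v≈ i′≡m+1) =
    e-v3v1 _ _ _ _ (trans (cong suc i≡m) (sym i′≡m+1)) refl refl
  edge-decodes vq3u0 (v≈ i≡q-1) (u≈ a≡0) = e-vq3u0 _ _ _ (cong suc i≡q-1) refl a≡0
  edge-decodes (uivi2 _ _) (u≈ a≡m+1) (v≈ i≡m) =
    e-uivi2 _ _ _ (trans a≡m+1 (cong suc (sym i≡m))) refl

  code-embedding : InducedEmbedding (KMbar q) codeGraph
  code-embedding = record
    { embed     = code
    ; injective = code-injective
    ; preserves = Sum.map code-preserves-edges code-preserves-edges
    ; reflects  = Sum.map (λ e → edge-decodes e (encodes _) (encodes _))
                          (λ e → edge-decodes e (encodes _) (encodes _))
    }

  open InducedEmbedding code-embedding using (equal-or-adjacent; preserves)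

  KM-2K₂-free : 2K₂-free (KM q)
  KM-2K₂-free = C₄-free⇒complement-2K₂-free (KMbar q) Sum.swap
    (C₄-free-embedding code-embedding codeGraph-C₄-free)

  Valid : Code → Set
  Valid (U n)   = n ≤ suc q
  Valid (V i _) = i < q

  code-valid : ∀ x → Valid (code x)
  code-valid (u a)   = m<1+n⇒m≤n (subst (toℕ a <_) (+-comm q 2) (toℕ<n a))
  code-valid (v i _) = toℕ<n i

  vertex : ∀ X → Valid X → KMVertex q
  vertex (U n)   n≤q+1 = u (fromℕ< (subst (n <_) (+-comm 2 q) (s≤s n≤q+1)))
  vertex (V i j) i<q   = v (fromℕ< i<q) j

  code-vertex : ∀ X (p : Valid X) → code (vertex X p) ≡ X
  code-vertex (U n)   _   = cong U (toℕ-fromℕ< _)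
  code-vertex (V i j) i<q = cong (λ m → V m j) (toℕ-fromℕ< i<q)

  clique-classes-via-code : (f : Code → ℕ) →
    (∀ {X Y} → Valid X → Valid Y → f X ≡ f Y → X ≡ Y ⊎ X ∼ Y) →
    ∀ x y → f (code x) ≡ f (code y) → x ≡ y ⊎ Adj (KMbar q) x y
  clique-classes-via-code f cliques x y same =
    equal-or-adjacent (cliques (code-valid x) (code-valid y) same)

  vertex-nonadjacent : ∀ {x} X (p : Valid X) → ¬ code x ∼ X → ¬ Adj (KMbar q) x (vertex X p)
  vertex-nonadjacent X p ¬xX adj = ¬xX (subst (_ ∼_) (code-vertex X p) (preserves adj))

  vertices-KM-adjacent : ∀ {X Y} (p : Valid X) (p′ : Valid Y) →
    X ≁ Y → Adj (KM q) (vertex X p) (vertex Y p′)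
  vertices-KM-adjacent {X} {Y} p p′ (X≢Y , ¬X∼Y) =
    (λ eq → X≢Y (trans (sym (code-vertex X p)) (trans (cong code eq) (code-vertex Y p′)))) ,
    vertex-nonadjacent Y p′ (subst (λ Z → ¬ Z ∼ Y) (sym (code-vertex X p)) ¬X∼Y)

  uColour : ℕ → ℕ
  uColour n with n ≟ suc q
  ... | yes _ = suc r
  ... | no  _ = pred n

  -- The classes are the triangles, {u₀,u₁}, {u_q,u_{q+1}} and the singletons u₂,…,u_{q-1}.
  colour₂ : Code → ℕ
  colour₂ (U n)   = uColour n
  colour₂ (V i _) = q + i

  uColour<q : ∀ {n} → n ≤ suc q → uColour n < q
  uColour<q {n} n≤q+1 with n ≟ suc q
  ... | yes _    = ≤-refl
  ... | no n≢q+1 = ≤-<-trans (pred-mono-≤ (m<1+n⇒m≤n (≤∧≢⇒< n≤q+1 n≢q+1))) ≤-refl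

  colour₂<2q : ∀ {X} → Valid X → colour₂ X < 2 * q
  colour₂<2q {U _}   n≤q+1 = <-≤-trans (uColour<q n≤q+1) (m≤m+n q (q + 0))
  colour₂<2q {V _ _} i<q   = +-monoʳ-< q (<-≤-trans i<q (m≤m+n q 0))

  pred-classes : ∀ n m → pred n ≡ pred m → U n ≡ U m ⊎ U n ∼ U m
  pred-classes zero    zero    _    = inj₁ refl
  pred-classes zero    (suc _) refl = inj₂ (inj₁ u0u1)
  pred-classes (suc _) zero    refl = inj₂ (inj₂ u0u1)
  pred-classes (suc n) (suc m) eq   = inj₁ (cong (U ∘ suc) eq)

  pred≡1+r⇒uq+1-adjacent : ∀ {m} → suc r ≡ pred m → U (suc q) ∼ U m
  pred≡1+r⇒uq+1-adjacent {zero}  ()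
  pred≡1+r⇒uq+1-adjacent {suc _} refl = inj₂ uquq1

  uColour-classes : ∀ n m → uColour n ≡ uColour m → U n ≡ U m ⊎ U n ∼ U m
  uColour-classes n m eq with n ≟ suc q | m ≟ suc q
  ... | yes refl | yes refl = inj₁ refl
  ... | yes refl | no _     = inj₂ (pred≡1+r⇒uq+1-adjacent eq)
  ... | no _     | yes refl = inj₂ (∼-sym (pred≡1+r⇒uq+1-adjacent (sym eq)))
  ... | no _     | no _     = pred-classes n m eq

  uColour≢block : ∀ {n} i → n ≤ suc q → uColour n ≢ q + i
  uColour≢block i n≤q+1 eq = <⇒≱ (uColour<q n≤q+1) (subst (q ≤_) (sym eq) (m≤m+n q i))

  colour₂-classes : ∀ {X Y} → Valid X → Valid Y → colour₂ X ≡ colour₂ Y → X ≡ Y ⊎ X ∼ Y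
  colour₂-classes {U n}   {U m}    _ _ eq = uColour-classes n m eq
  colour₂-classes {U _}   {V i _}  p _ eq = ⊥-elim (uColour≢block i p eq)
  colour₂-classes {V i _} {U _}    _ p eq = ⊥-elim (uColour≢block i p (sym eq))
  colour₂-classes {V i j} {V i′ k} _ _ eq with +-cancelˡ-≡ q i i′ eq
  ... | refl = block-clique i j k

  InClique : Code → Set
  InClique (U n)   = 0 < n × n ≤ q
  InClique (V _ j) = j ≡ j₁

  clique-no-edge : ∀ {X Y} → InClique X → InClique Y → ¬ Edge X Y
  clique-no-edge (() , _)      _             u0u1
  clique-no-edge _             (_ , q+1≤q)   uquq1  = n≮n q q+1≤q
  clique-no-edge (_ , q+1≤q)   _             uq1v11 = n≮n q q+1≤q
  clique-no-edge _             ()            (v12 _)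
  clique-no-edge ()            _             (v23 _)
  clique-no-edge _             ()            (v13 _)
  clique-no-edge ()            _             (v3v1 _ _)
  clique-no-edge ()            _             vq3u0
  clique-no-edge _             ()            (uivi2 _ _)

  cliqueCode : Fin 2 × Fin q → Code
  cliqueCode (zero , i)     = V (toℕ i) j₁
  cliqueCode (suc zero , i) = U (suc (toℕ i))

  cliqueCode-valid : ∀ s → Valid (cliqueCode s)
  cliqueCode-valid (zero , i)     = toℕ<n i
  cliqueCode-valid (suc zero , i) = s≤s (<⇒≤ (toℕ<n i))

  cliqueCode-in-clique : ∀ s → InClique (cliqueCode s)
  cliqueCode-in-clique (zero , i)     = refl
  cliqueCode-in-clique (suc zero , i) = s≤s z≤n , toℕ<n i

  cliqueCode-injective : ∀ {s t} → cliqueCode s ≡ cliqueCode t → s ≡ t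
  cliqueCode-injective {zero , _}     {zero , _}     eq =
    cong (zero ,_) (toℕ-injective (proj₁ (V-injective eq)))
  cliqueCode-injective {suc zero , _} {suc zero , _} eq =
    cong (suc zero ,_) (toℕ-injective (suc-injective (U-injective eq)))
  cliqueCode-injective {zero , _}     {suc zero , _} ()
  cliqueCode-injective {suc zero , _} {zero , _}     ()

  cliqueCode-nonadjacent : ∀ s t → s ≢ t → cliqueCode s ≁ cliqueCode t
  cliqueCode-nonadjacent s t s≢t =
    s≢t ∘ cliqueCode-injective ,
    [ clique-no-edge (cliqueCode-in-clique s) (cliqueCode-in-clique t)
    , clique-no-edge (cliqueCode-in-clique t) (cliqueCode-in-clique s) ]′

  cliqueVertex : Fin (2 * q) → KMVertex q
  cliqueVertex s = vertex (cliqueCode (Inverse.to *↔× s)) (cliqueCode-valid _)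

  cliqueVertex-clique : ∀ {s t} → s ≢ t → Adj (KM q) (cliqueVertex s) (cliqueVertex t)
  cliqueVertex-clique s≢t = vertices-KM-adjacent _ _
    (cliqueCode-nonadjacent _ _ (s≢t ∘ Injection.injective (↔⇒↣ *↔×)))

  KM-chromatic : ChromaticNumber (KM q) (2 * q)
  KM-chromatic =
    (colouring , clique-classes⇒colouring (clique-classes-via-code colour₂ colour₂-classes)) ,
    λ k k<2q → clique⇒¬colourable (KM q) cliqueVertex cliqueVertex-clique k<2q
    where open ComplementColouring (KMbar q) (colour₂ ∘ code) (colour₂<2q ∘ code-valid)

  external-valid : ∀ {X Y} → ExternalEdge X Y → Valid X × Valid Y
  external-valid ext-v11           = s≤s z≤n , ≤-refl
  external-valid (ext-vi1 _ i+1<q) = i+1<q , ≤-trans (n≤1+n _) i+1<q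
  external-valid (ext-vi2 _ i<q)   = i<q , s≤s (<⇒≤ i<q)
  external-valid (ext-vi3 _ i+1<q) = ≤-trans (n≤1+n _) i+1<q , i+1<q
  external-valid ext-vq3           = ≤-refl , z≤n

  outsider-nonadjacent : ∀ {i j O X} →
    ExternalEdge (V i j) O → (∀ {k} → X ≢ V i k) → X ≢ O → ¬ X ∼ V i j
  outsider-nonadjacent ext outside X≢O X∼T with block-or-external (∼-sym X∼T)
  ... | inj₁ (_ , X≡V) = outside X≡V
  ... | inj₂ ext′      = X≢O (external-unique ext′ ext)

  mate-nonadjacent : ∀ {i j k O} → ExternalEdge (V i j) O → V i k ≢ V i j → ¬ V i k ∼ O
  mate-nonadjacent ext k≢j kO with block-or-external kO
  ... | inj₁ (_ , refl) = external-leaves-block ext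
  ... | inj₂ ext′       = k≢j (external-injective ext′ ext)

  external-edge-separates :
    ∀ {T O X} → ExternalEdge T O → X ≢ T → X ≢ O → ¬ X ∼ T ⊎ ¬ X ∼ O
  external-edge-separates {U _} ()
  external-edge-separates {V _ _} {X = U _} ext _ X≢O =
    inj₁ (outsider-nonadjacent ext (λ ()) X≢O)
  external-edge-separates {V i _} {X = V i′ _} ext X≢T X≢O with i′ ≟ i
  ... | yes refl = inj₂ (mate-nonadjacent ext X≢T)
  ... | no i′≢i  = inj₁ (outsider-nonadjacent ext (i′≢i ∘ proj₁ ∘ V-injective) X≢O)

  -- In the paper's notation, chord i is u_{i+1}v_{(i+1)2}, entry is u_{q+1}v_{11}, and
  -- exit i joins v_{(i+1)3} to its successor on the Hamiltonian cycle.
  data MatchingEdge : Set where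
    chord exit : (i : ℕ) → i < q → MatchingEdge
    entry      : MatchingEdge

  inner outer : MatchingEdge → Code
  inner (chord i _) = V i j₂
  inner entry       = V 0 j₁
  inner (exit i _)  = V i j₃
  outer (chord i _) = U (suc i)
  outer entry       = U (suc q)
  outer (exit i _) with i ≟ suc r
  ... | yes _ = U 0
  ... | no  _ = V (suc i) j₁

  outer-exit-last : ∀ p → outer (exit (suc r) p) ≡ U 0
  outer-exit-last _ with suc r ≟ suc r
  ... | yes _  = refl
  ... | no r≢r = ⊥-elim (r≢r refl)

  outer-exit : ∀ {i} (i<q : i < q) → suc i < q → outer (exit i i<q) ≡ V (suc i) j₁
  outer-exit {i} _ i+1<q with i ≟ suc r
  ... | yes refl = ⊥-elim (n≮n _ i+1<q)
  ... | no _     = refl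

  matching-external : ∀ e → ExternalEdge (inner e) (outer e)
  matching-external (chord i i<q) = ext-vi2 i i<q
  matching-external entry         = ext-v11
  matching-external (exit i i<q) with i ≟ suc r
  ... | yes refl = ext-vq3
  ... | no i≢1+r = ext-vi3 i (s≤s (≤∧≢⇒< (s≤s⁻¹ i<q) i≢1+r))

  OnEdge : Code → MatchingEdge → Set
  OnEdge X e = X ≡ inner e ⊎ X ≡ outer e

  on-edge-valid : ∀ {X} e → OnEdge X e → Valid X
  on-edge-valid e (inj₁ refl) = proj₁ (external-valid (matching-external e))
  on-edge-valid e (inj₂ refl) = proj₂ (external-valid (matching-external e))

  matching-perfect : ∀ {X} → Valid X → ∃ (OnEdge X)
  matching-perfect {U zero}    _ = exit (suc r) ≤-refl , inj₂ (sym (outer-exit-last ≤-refl))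
  matching-perfect {U (suc n)} n+1≤q+1 with n ≟ q
  ... | yes refl = entry , inj₂ refl
  ... | no n≢q   = chord n (≤∧≢⇒< (s≤s⁻¹ n+1≤q+1) n≢q) , inj₂ refl
  matching-perfect {V zero j₁}    _     = entry , inj₁ refl
  matching-perfect {V (suc i) j₁} i+1<q = exit i i<q , inj₂ (sym (outer-exit i<q i+1<q))
    where i<q = ≤-trans (n≤1+n _) i+1<q
  matching-perfect {V i j₂}       i<q   = chord i i<q , inj₁ refl
  matching-perfect {V i j₃}       i<q   = exit i i<q , inj₁ refl

  matching-edge-clique : ∀ {X Y} e → OnEdge X e → OnEdge Y e → X ≡ Y ⊎ X ∼ Y
  matching-edge-clique e (inj₁ refl) (inj₁ refl) = inj₁ refl
  matching-edge-clique e (inj₁ refl) (inj₂ refl) =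
    inj₂ (external-adjacent (matching-external e))
  matching-edge-clique e (inj₂ refl) (inj₁ refl) =
    inj₂ (∼-sym (external-adjacent (matching-external e)))
  matching-edge-clique e (inj₂ refl) (inj₂ refl) = inj₁ refl

  matching-edge-separates : ∀ {X} e → ¬ OnEdge X e → ∃ λ W → OnEdge W e × ¬ X ∼ W
  matching-edge-separates e X∉e
    with external-edge-separates (matching-external e) (X∉e ∘ inj₁) (X∉e ∘ inj₂)
  ... | inj₁ ¬X∼inner = inner e , inj₁ refl , ¬X∼inner
  ... | inj₂ ¬X∼outer = outer e , inj₂ refl , ¬X∼outer

  colour : MatchingEdge → ℕ
  colour (chord i _) = i
  colour entry       = q
  colour (exit i _)  = suc (q + i)

  colour₃ : Code → ℕ
  colour₃ (U zero)       = suc (q + suc r)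
  colour₃ (U (suc n))    = n
  colour₃ (V i j₂)       = i
  colour₃ (V i j₃)       = suc (q + i)
  colour₃ (V zero j₁)    = q
  colour₃ (V (suc i) j₁) = suc (q + i)

  colour₃-on-edge : ∀ {X} e → OnEdge X e → colour₃ X ≡ colour e
  colour₃-on-edge (chord _ _) (inj₁ refl) = refl
  colour₃-on-edge entry       (inj₁ refl) = refl
  colour₃-on-edge (exit _ _)  (inj₁ refl) = refl
  colour₃-on-edge (chord _ _) (inj₂ refl) = refl
  colour₃-on-edge entry       (inj₂ refl) = refl
  colour₃-on-edge (exit i _)  (inj₂ refl) with i ≟ suc r
  ... | yes refl = refl
  ... | no  _    = refl

  exit-colour≮q : ∀ i → ¬ suc (q + i) < q
  exit-colour≮q i lt = <⇒≱ lt (≤-trans (m≤m+n q i) (n≤1+n _))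

  colour-injective : ∀ {e e′} → colour e ≡ colour e′ → e ≡ e′
  colour-injective {chord i p} {chord .i p′} refl = cong (chord i) (<-irrelevant p p′)
  colour-injective {chord _ p} {entry}       refl = ⊥-elim (n≮n q p)
  colour-injective {chord _ p} {exit i _}    refl = ⊥-elim (exit-colour≮q i p)
  colour-injective {entry}     {chord _ p}   refl = ⊥-elim (n≮n q p)
  colour-injective {entry}     {entry}       _    = refl
  colour-injective {entry}     {exit _ _}    eq   = ⊥-elim (m≢1+m+n q eq)
  colour-injective {exit i _}  {chord _ p}   refl = ⊥-elim (exit-colour≮q i p)
  colour-injective {exit _ _}  {entry}       eq   = ⊥-elim (m≢1+m+n q (sym eq))
  colour-injective {exit i p}  {exit i′ p′}  eq   with +-cancelˡ-≡ q i i′ (suc-injective eq)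
  ... | refl = cong (exit i) (<-irrelevant p p′)

  2q+1≡1+q+q : 2 * q + 1 ≡ suc (q + q)
  2q+1≡1+q+q = trans (+-comm (2 * q) 1) (cong (λ m → suc (q + m)) (+-identityʳ q))

  colour<2q+1 : ∀ e → colour e < 2 * q + 1
  colour<2q+1 e = subst (colour e <_) (sym 2q+1≡1+q+q) (bound e)
    where
    bound : ∀ e → colour e < suc (q + q)
    bound (chord _ i<q) = <-≤-trans i<q (≤-trans (m≤m+n q q) (n≤1+n _))
    bound entry         = s≤s (m≤m+n q q)
    bound (exit _ i<q)  = s≤s (+-monoʳ-< q i<q)

  colour-surjective : ∀ n → n < 2 * q + 1 → ∃ λ e → colour e ≡ n
  colour-surjective n n<2q+1 with <-cmp n q
  ... | tri< n<q _ _  = chord n n<q , refl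
  ... | tri≈ _ refl _ = entry , refl
  ... | tri> _ _ q<n  with m≤n⇒∃[o]m+o≡n q<n
  ...   | i , refl = exit i i<q , refl
    where i<q = +-cancelˡ-< q i q (s<s⁻¹ (subst (suc (q + i) <_) 2q+1≡1+q+q n<2q+1))

  colour₃<2q+1 : ∀ {X} → Valid X → colour₃ X < 2 * q + 1
  colour₃<2q+1 valid with matching-perfect valid
  ... | e , X∈e = subst (_< 2 * q + 1) (sym (colour₃-on-edge e X∈e)) (colour<2q+1 e)

  colour₃-classes : ∀ {X Y} → Valid X → Valid Y → colour₃ X ≡ colour₃ Y → X ≡ Y ⊎ X ∼ Y
  colour₃-classes pX pY same with matching-perfect pX | matching-perfect pY
  ... | e , X∈e | e′ , Y∈e′ with colour-injective {e} {e′}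
    (trans (sym (colour₃-on-edge e X∈e)) (trans same (colour₃-on-edge e′ Y∈e′)))
  ... | refl = matching-edge-clique e X∈e Y∈e′

  non-neighbour-of-colour : ∀ X n → n < 2 * q + 1 → n ≢ colour₃ X →
    ∃ λ W → Valid W × colour₃ W ≡ n × ¬ X ∼ W
  non-neighbour-of-colour X n n<2q+1 n≢cX with colour-surjective n n<2q+1
  ... | e , refl with matching-edge-separates e (n≢cX ∘ sym ∘ colour₃-on-edge e)
  ... | W , W∈e , ¬X∼W = W , on-edge-valid e W∈e , colour₃-on-edge e W∈e , ¬X∼W

  KM-frozen : HasFrozenColouring (KM q) (2 * q + 1)
  KM-frozen =
    colouring ,
    clique-classes⇒colouring (clique-classes-via-code colour₃ colour₃-classes) ,
    non-neighbours⇒frozen non-neighbour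
    where
    open ComplementColouring (KMbar q) (colour₃ ∘ code) (colour₃<2q+1 ∘ code-valid)
    non-neighbour : ∀ x n → n < 2 * q + 1 → n ≢ colour₃ (code x) →
      ∃ λ w → colour₃ (code w) ≡ n × ¬ Adj (KMbar q) x w
    non-neighbour x n n<2q+1 n≢cx with non-neighbour-of-colour (code x) n n<2q+1 n≢cx
    ... | W , W-valid , cW≡n , ¬xW =
      vertex W W-valid , trans (cong colour₃ (code-vertex W W-valid)) cW≡n ,
      vertex-nonadjacent W W-valid ¬xW

corollary7 : (q : ℕ) → 2 ≤ q →
    2K₂-free (KM q) × ChromaticNumber (KM q) (2 * q) × HasFrozenColouring (KM q) (2 * q + 1)
corollary7 (suc (suc r)) (s≤s (s≤s z≤n)) = KM-2K₂-free , KM-chromatic , KM-frozen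
  where open Structure r
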